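{- Let $G$ be a disconnected graph of order $n$. Then $PRC(G)=n$ if and only if $G\simeq K_s\cup K_r$ (disjoint union of two complete graphs) for some positive integers $r,s\geq 1$.
   Context: All graphs are simple, finite and undirected. A set $S\subseteq V(G)$ is a dominating set if every vertex not in $S$ has a neighbor in $S$; $S$ is a perfect dominating set if every vertex in $V(G)\setminus S$ has exactly one neighbor in $S$. A perfect coalition in $G$ consists of two disjoint sets $V_1,V_2$ of vertices such that (i) neither $V_1$ nor $V_2$ is a dominating set of $G$; (ii) each vertex in $V(G)\setminus V_1$ has at most one neighbor in $V_1$, and each vertex in $V(G)\setminus V_2$ has at most one neighbor in $V_2$; (iii) $V_1\cup V_2$ is a perfect dominating set of $G$. A perfect coalition partition ($prc$-partition) of $G$ is a vertex partition $\pi=\{V_1,\dots,V_k\}$ such that each $V_i$ either is a singleton dominating set or forms a perfect coalition with some $V_j\in\pi$. $PRC(G)$ is the maximum cardinality of a $prc$-partition of $G$, with $PRC(G)=0$ if $G$ has no $prc$-partition. -}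

module Defs where

open import Level using (0ℓ)
open import Data.Nat using (ℕ; zero; suc; _+_; _≤_)
open import Data.Fin using (Fin; splitAt)
open import Data.Sum using (_⊎_; inj₁; inj₂)
open import Data.Product using (Σ; ∃; ∃-syntax; _×_; _,_)
open import Data.Empty using (⊥)
open import Relation.Nullary using (¬_)
open import Relation.Binary.PropositionalEquality using (_≡_; _≢_)
open import Function.Bundles using (_↔_; _⇔_; Inverse)

record Graph (n : ℕ) : Set₁ where
  field
    Adj     : Fin n → Fin n → Set
    sym     : ∀ {u v} → Adj u v → Adj v u
    irrefl  : ∀ {u} → ¬ Adj u u
open Graph public

VSet : ℕ → Set₁
VSet n = Fin n → Set

module _ {n : ℕ} (G : Graph n) where

  Dominating : VSet n → Set
  Dominating S = ∀ v → ¬ S v → ∃[ u ] (S u × Adj G v u)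

  ExactlyOneNbr : VSet n → Fin n → Set
  ExactlyOneNbr S v = ∃[ u ] (S u × Adj G v u × (∀ w → S w → Adj G v w → w ≡ u))

  AtMostOneNbr : VSet n → Fin n → Set
  AtMostOneNbr S v = ∀ u w → S u → S w → Adj G v u → Adj G v w → u ≡ w

  PerfectDominating : VSet n → Set
  PerfectDominating S = ∀ v → ¬ S v → ExactlyOneNbr S v

  Disjoint : VSet n → VSet n → Set
  Disjoint A B = ∀ v → A v → B v → ⊥

  Union : VSet n → VSet n → VSet n
  Union A B v = A v ⊎ B v

  PerfectCoalition : VSet n → VSet n → Set
  PerfectCoalition V₁ V₂ =
    Disjoint V₁ V₂ ×
    ¬ Dominating V₁ × ¬ Dominating V₂ ×
    (∀ v → ¬ V₁ v → AtMostOneNbr V₁ v) ×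
    (∀ v → ¬ V₂ v → AtMostOneNbr V₂ v) ×
    PerfectDominating (Union V₁ V₂)

  Singleton : VSet n → Set
  Singleton S = ∃[ v ] (∀ w → S w ⇔ (w ≡ v))

  record Partition (k : ℕ) : Set where
    field
      cls      : Fin n → Fin k
      nonempty : ∀ i → ∃[ v ] (cls v ≡ i)
    Block : Fin k → VSet n
    Block i v = cls v ≡ i

  IsPrcPartition : {k : ℕ} → Partition k → Set
  IsPrcPartition {k} π =
    ∀ i → (Singleton (Block i) × Dominating (Block i))
        ⊎ (∃[ j ] (j ≢ i × PerfectCoalition (Block i) (Block j)))
    where open Partition π

  HasPrcPartition : ℕ → Set
  HasPrcPartition k = Σ (Partition k) IsPrcPartition

  -- PRC(G) ≡ m : m is the maximum cardinality of a prc-partition,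
  -- or m = 0 and G has no prc-partition.
  PRCis : ℕ → Set
  PRCis m = (HasPrcPartition m × (∀ k → HasPrcPartition k → k ≤ m))
          ⊎ (m ≡ 0 × (∀ k → ¬ HasPrcPartition k))

  data Reachable : Fin n → Fin n → Set where
    here : ∀ {u} → Reachable u u
    step : ∀ {u v w} → Adj G u v → Reachable v w → Reachable u w

  Connected : Set
  Connected = ∀ u v → Reachable u v

  Disconnected : Set
  Disconnected = ¬ Connected

K : (m : ℕ) → Graph m
K m = record
  { Adj    = λ u v → u ≢ v
  ; sym    = λ u≢v v≡u → u≢v (Relation.Binary.PropositionalEquality.sym v≡u)
  ; irrefl = λ u≢u → u≢u Relation.Binary.PropositionalEquality.refl
  }

private
  UAdj : ∀ {a b} → Graph a → Graph b → Fin a ⊎ Fin b → Fin a ⊎ Fin b → Set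
  UAdj G H (inj₁ x) (inj₁ y) = Adj G x y
  UAdj G H (inj₂ x) (inj₂ y) = Adj H x y
  UAdj G H (inj₁ _) (inj₂ _) = ⊥
  UAdj G H (inj₂ _) (inj₁ _) = ⊥

  USym : ∀ {a b} (G : Graph a) (H : Graph b) x y → UAdj G H x y → UAdj G H y x
  USym G H (inj₁ x) (inj₁ y) p = sym G p
  USym G H (inj₂ x) (inj₂ y) p = sym H p

  UIrr : ∀ {a b} (G : Graph a) (H : Graph b) x → ¬ UAdj G H x x
  UIrr G H (inj₁ x) = irrefl G
  UIrr G H (inj₂ x) = irrefl H

-- disjoint union: vertices 0..a-1 from G, a..a+b-1 from H
_∪ᴳ_ : ∀ {a b} → Graph a → Graph b → Graph (a + b)
_∪ᴳ_ {a} G H = record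
  { Adj    = λ u v → UAdj G H (splitAt a u) (splitAt a v)
  ; sym    = λ {u} {v} → USym G H (splitAt a u) (splitAt a v)
  ; irrefl = λ {u} → UIrr G H (splitAt a u)
  }

_≅_ : ∀ {n m} → Graph n → Graph m → Set
_≅_ {n} {m} G H =
  Σ (Fin n ↔ Fin m) λ φ →
    ∀ u v → Adj G u v ⇔ Adj H (Inverse.to φ u) (Inverse.to φ v)

{-# OPTIONS --safe #-}
module Submission where

-- If PRC(G) = n, a prc-partition into n blocks consists of singletons.  A singleton cannot
-- dominate a disconnected graph, so every vertex x has a partner x' such that every other vertex
-- is adjacent to x or to x'.  Fix one such pair {v, u}: every vertex lies in N[v] or N[u], and an
-- edge between the two would connect G.  Hence N[v] and N[u] split G into two parts with no edge
-- between them, the partner of each x lies in the other part, and so x is adjacent to every other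
-- vertex of its own part.  Conversely, in K_s ∪ K_r two vertices from different cliques form a
-- perfect coalition of singletons, which yields a prc-partition into n singletons.

open import Defs
open import Data.Bool using (Bool; true; false; not)
open import Data.Bool.Properties using (not-¬; ¬-not; not-involutive) renaming (_≟_ to _≟ᵇ_)
open import Data.Empty using (⊥-elim)
open import Data.Fin using (Fin; zero; suc; splitAt; join; punchOut)
open import Data.Fin.Properties
  using (_≟_; any?; punchOut-injective; injective⇒≤; <⇒notInjective; +↔⊎; splitAt-join)
open import Data.Nat using (ℕ; zero; suc; _+_; _≤_; _≥_; z≤n; s≤s)
open import Data.Nat.Properties using (n<1+n)
open import Data.Product using (Σ; ∃-syntax; _×_; _,_; proj₁; proj₂)
open import Data.Sum using (_⊎_; inj₁; inj₂; [_,_]′; map₁; swap)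
open import Data.Sum.Properties using (inj₁-injective; inj₂-injective; swap-↔)
open import Function using (_∘_; id)
open import Function.Bundles using (_⇔_; _↔_; Inverse; Injection; mk⇔; mk↔ₛ′; Equivalence)
open import Function.Construct.Composition using (_↔-∘_)
open import Function.Construct.Symmetry using (↔-sym)
open import Function.Definitions using (Injective)
open import Function.Properties.Equivalence using () renaming (trans to ⇔-trans; sym to ⇔-sym)
open import Function.Properties.Inverse using (↔⇒↣)
open import Relation.Nullary using (¬_; yes; no)
open import Relation.Nullary.Decidable using (decidable-stable)
open import Relation.Binary.PropositionalEquality
  using (_≡_; _≢_; refl; cong; subst; trans) renaming (sym to ≡-sym)

open Inverse using (to; from; strictlyInverseˡ; strictlyInverseʳ)

Fin-injective⇒surjective : ∀ {n} (f : Fin n → Fin n) → Injective _≡_ _≡_ f → ∀ y → ∃[ x ] f x ≡ y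
Fin-injective⇒surjective {suc m} f f-inj y with any? (λ x → f x ≟ y)
... | yes hit = hit
... | no miss = ⊥-elim (<⇒notInjective (n<1+n m) g-inj)
  where
    y≢f : ∀ x → y ≢ f x
    y≢f x e = miss (x , ≡-sym e)
    g : Fin (suc m) → Fin m
    g x = punchOut (y≢f x)
    g-inj : Injective _≡_ _≡_ g
    g-inj {x} {x′} e = f-inj (punchOut-injective (y≢f x) (y≢f x′) e)

↔-injective : ∀ {A B : Set} (φ : A ↔ B) → Injective _≡_ _≡_ (to φ)
↔-injective φ = Injection.injective (↔⇒↣ φ)

module _ {n : ℕ} (G : Graph n) where

  reach-trans : ∀ {a b c} → Reachable G a b → Reachable G b c → Reachable G a c
  reach-trans here      q = q
  reach-trans (step e p) q = step e (reach-trans p q)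

  reach-sym : ∀ {a b} → Reachable G a b → Reachable G b a
  reach-sym here       = here
  reach-sym (step e p) = reach-trans (reach-sym p) (step (sym G e) here)

  reachAll⇒connected : ∀ v → (∀ w → Reachable G w v) → Connected G
  reachAll⇒connected v to-v a b = reach-trans (to-v a) (reach-sym (to-v b))

  dominating-⊆singleton⇒connected : ∀ {S x} → Dominating G S → (∀ w → S w → w ≡ x) →
                                     Connected G
  dominating-⊆singleton⇒connected {S} {x} dom S⊆x = reachAll⇒connected x to-x
    where
      to-x : ∀ w → Reachable G w x
      to-x w with w ≟ x
      ... | yes refl = here
      ... | no w≢x with dom w (w≢x ∘ S⊆x w)
      ... | z , Sz , w~z = step w~z (subst (Reachable G z) (S⊆x z Sz) here)

  PairDominating : Fin n → Fin n → Set
  PairDominating x y = ∀ w → w ≢ x → w ≢ y → Adj G w x ⊎ Adj G w y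

disconnected⇒vertex : ∀ {n} (G : Graph n) → Disconnected G → Fin n
disconnected⇒vertex {zero}  G disc = ⊥-elim (disc λ ())
disconnected⇒vertex {suc _} G _    = zero

module _ {n : ℕ} {G : Graph n} {k : ℕ} (π : Partition G k) where
  open Partition π

  representative : Fin k → Fin n
  representative i = proj₁ (nonempty i)

  cls-representative : ∀ i → cls (representative i) ≡ i
  cls-representative i = proj₂ (nonempty i)

  representative-injective : Injective _≡_ _≡_ representative
  representative-injective {i} {j} e =
    trans (≡-sym (cls-representative i)) (trans (cong cls e) (cls-representative j))

  partition-size≤ : k ≤ n
  partition-size≤ = injective⇒≤ representative-injective

cls-injective : ∀ {n} {G : Graph n} (π : Partition G n) → Injective _≡_ _≡_ (Partition.cls π)
cls-injective π {v} {w} e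
  with Fin-injective⇒surjective _ (representative-injective π) v
     | Fin-injective⇒surjective _ (representative-injective π) w
... | i , refl | j , refl =
  cong (representative π)
    (trans (≡-sym (cls-representative π i)) (trans e (cls-representative π j)))

discrete : ∀ {n} (G : Graph n) → Partition G n
discrete G = record { cls = id ; nonempty = λ i → i , refl }

-- Two cliques, described by a colouring that marks the clique of each vertex

SameClique : {A : Set} → (A → Bool) → A → A → Set
SameClique c x y = c x ≡ c y × x ≢ y

record TwoCliques {n : ℕ} (G : Graph n) (c : Fin n → Bool) : Set where
  constructor twoCliques
  field
    adj⇔ : ∀ x y → Adj G x y ⇔ SameClique c x y
open TwoCliques

UnionOfTwoCliques : ∀ {n} → Graph n → Set
UnionOfTwoCliques G = ∃[ c ] (TwoCliques G c × (∀ b → ∃[ x ] c x ≡ b))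

sameClique-↔ : ∀ {A B : Set} {c : A → Bool} {d : B → Bool} (φ : A ↔ B) →
               (∀ x → d (to φ x) ≡ c x) →
               ∀ x y → SameClique c x y ⇔ SameClique d (to φ x) (to φ y)
sameClique-↔ φ dφ≡c x y = mk⇔
  (λ (cx≡cy , x≢y) → trans (dφ≡c x) (trans cx≡cy (≡-sym (dφ≡c y))) , x≢y ∘ ↔-injective φ)
  (λ (dx≡dy , φx≢φy) → trans (≡-sym (dφ≡c x)) (trans dx≡dy (dφ≡c y)) , φx≢φy ∘ cong (to φ))

twoCliques⇒≅ : ∀ {n m} {G : Graph n} {H : Graph m} {c d} → TwoCliques G c → TwoCliques H d →
               (φ : Fin n ↔ Fin m) → (∀ x → d (to φ x) ≡ c x) → G ≅ H
twoCliques⇒≅ {c = c} {d} tcG tcH φ dφ≡c = φ , λ x y →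
  ⇔-trans (adj⇔ tcG x y)
    (⇔-trans (sameClique-↔ {c = c} {d} φ dφ≡c x y) (⇔-sym (adj⇔ tcH (to φ x) (to φ y))))

≅-twoCliques : ∀ {n m} {G : Graph n} {H : Graph m} {d} (iso : G ≅ H) → TwoCliques H d →
               TwoCliques G (d ∘ to (proj₁ iso))
≅-twoCliques {d = d} (φ , iso⇔) tcH = twoCliques λ x y →
  ⇔-trans (iso⇔ x y)
    (⇔-trans (adj⇔ tcH (to φ x) (to φ y))
      (⇔-sym (sameClique-↔ {c = d ∘ to φ} {d} φ (λ _ → refl) x y)))

isLeft : {A B : Set} → A ⊎ B → Bool
isLeft (inj₁ _) = true
isLeft (inj₂ _) = false

K∪K-adj⇔ : ∀ s r a b → Adj (K s ∪ᴳ K r) a b ⇔ SameClique isLeft (splitAt s a) (splitAt s b)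
K∪K-adj⇔ s r a b with splitAt s a | splitAt s b
... | inj₁ i | inj₁ j = mk⇔ (λ i≢j → refl , i≢j ∘ inj₁-injective) (λ (_ , ne) → ne ∘ cong inj₁)
... | inj₂ i | inj₂ j = mk⇔ (λ i≢j → refl , i≢j ∘ inj₂-injective) (λ (_ , ne) → ne ∘ cong inj₂)
... | inj₁ i | inj₂ j = mk⇔ (λ ()) (λ ())
... | inj₂ i | inj₁ j = mk⇔ (λ ()) (λ ())

twoCliques-K∪K : ∀ s r → TwoCliques (K s ∪ᴳ K r) (isLeft ∘ splitAt s)
twoCliques-K∪K s r = twoCliques λ a b →
  ⇔-trans (K∪K-adj⇔ s r a b)
    (⇔-sym (sameClique-↔ {c = isLeft ∘ splitAt s} {isLeft} +↔⊎ (λ _ → refl) a b))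

isLeft-map₁ : ∀ {A A′ B : Set} (f : A → A′) (y : A ⊎ B) → isLeft (map₁ f y) ≡ isLeft y
isLeft-map₁ f (inj₁ _) = refl
isLeft-map₁ f (inj₂ _) = refl

isLeft-swap : ∀ {A B : Set} (y : A ⊎ B) → isLeft (swap y) ≡ not (isLeft y)
isLeft-swap (inj₁ _) = refl
isLeft-swap (inj₂ _) = refl

Fin⇒≥1 : ∀ {s} → Fin s → s ≥ 1
Fin⇒≥1 zero    = s≤s z≤n
Fin⇒≥1 (suc _) = s≤s z≤n

left-inhabited : ∀ {s r} (y : Fin s ⊎ Fin r) → isLeft y ≡ true → s ≥ 1
left-inhabited (inj₁ i) _ = Fin⇒≥1 i

right-inhabited : ∀ {s r} (y : Fin s ⊎ Fin r) → isLeft y ≡ false → r ≥ 1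
right-inhabited (inj₂ j) _ = Fin⇒≥1 j

record ColourSplit (n : ℕ) (c : Fin n → Bool) : Set where
  field
    s r      : ℕ
    ψ        : Fin n ↔ (Fin s ⊎ Fin r)
    isLeft-ψ : ∀ x → isLeft (to ψ x) ≡ c x

swap-colourSplit : ∀ {n c} → ColourSplit n (not ∘ c) → ColourSplit n c
swap-colourSplit {c = c} S = record
  { ψ        = swap-↔ ↔-∘ ψ
  ; isLeft-ψ = λ x →
      trans (isLeft-swap (to ψ x)) (trans (cong not (isLeft-ψ x)) (not-involutive (c x)))
  }
  where open ColourSplit S

cons-colourSplit : ∀ {n c} → c zero ≡ true → ColourSplit n (c ∘ suc) → ColourSplit (suc n) c
cons-colourSplit {n} {c} c₀≡true S = record
  { ψ        = mk↔ₛ′ to′ from′ to′∘from′ from′∘to′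
  ; isLeft-ψ = isLeft-to′
  }
  where
    open ColourSplit S
    to′ : Fin (suc n) → Fin (suc s) ⊎ Fin r
    to′ zero    = inj₁ zero
    to′ (suc x) = map₁ suc (to ψ x)
    from′ : Fin (suc s) ⊎ Fin r → Fin (suc n)
    from′ (inj₁ zero)    = zero
    from′ (inj₁ (suc i)) = suc (from ψ (inj₁ i))
    from′ (inj₂ j)       = suc (from ψ (inj₂ j))
    from′-map₁ : ∀ y → from′ (map₁ suc y) ≡ suc (from ψ y)
    from′-map₁ (inj₁ _) = refl
    from′-map₁ (inj₂ _) = refl
    to′∘from′ : ∀ y → to′ (from′ y) ≡ y
    to′∘from′ (inj₁ zero)    = refl
    to′∘from′ (inj₁ (suc i)) = cong (map₁ suc) (strictlyInverseˡ ψ (inj₁ i))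
    to′∘from′ (inj₂ j)       = cong (map₁ suc) (strictlyInverseˡ ψ (inj₂ j))
    from′∘to′ : ∀ x → from′ (to′ x) ≡ x
    from′∘to′ zero    = refl
    from′∘to′ (suc x) = trans (from′-map₁ (to ψ x)) (cong suc (strictlyInverseʳ ψ x))
    isLeft-to′ : ∀ x → isLeft (to′ x) ≡ c x
    isLeft-to′ zero    = ≡-sym c₀≡true
    isLeft-to′ (suc x) = trans (isLeft-map₁ suc (to ψ x)) (isLeft-ψ x)

colourSplit : ∀ n c → ColourSplit n c
colourSplit zero    c = record { ψ = +↔⊎ {0} {0} ; isLeft-ψ = λ () }
colourSplit (suc n) c with c zero in c₀
... | true  = cons-colourSplit c₀ (colourSplit n (c ∘ suc))
... | false = swap-colourSplit (cons-colourSplit (cong not c₀) (colourSplit n (not ∘ c ∘ suc)))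

≅K∪K⇔unionOfTwoCliques : ∀ {n} (G : Graph n) →
  (∃[ s ] ∃[ r ] (s ≥ 1 × r ≥ 1 × G ≅ (K s ∪ᴳ K r))) ⇔ UnionOfTwoCliques G
≅K∪K⇔unionOfTwoCliques {n} G = mk⇔ toCliques fromCliques
  where
    toCliques : ∃[ s ] ∃[ r ] (s ≥ 1 × r ≥ 1 × G ≅ (K s ∪ᴳ K r)) → UnionOfTwoCliques G
    toCliques (s , r , s≤s z≤n , s≤s z≤n , iso@(φ , _)) =
      isLeft ∘ splitAt s ∘ to φ , ≅-twoCliques iso (twoCliques-K∪K s r) , λ where
        true  → from φ (join s r (inj₁ zero)) , colour-from (inj₁ zero)
        false → from φ (join s r (inj₂ zero)) , colour-from (inj₂ zero)
      where
        colour-from : ∀ y → isLeft (splitAt s (to φ (from φ (join s r y)))) ≡ isLeft y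
        colour-from y = trans (cong (isLeft ∘ splitAt s) (strictlyInverseˡ φ (join s r y)))
                              (cong isLeft (splitAt-join s r y))
    fromCliques : UnionOfTwoCliques G → ∃[ s ] ∃[ r ] (s ≥ 1 × r ≥ 1 × G ≅ (K s ∪ᴳ K r))
    fromCliques (c , tc , hasColour) with hasColour true | hasColour false
    ... | v , cv | u , cu =
      s , r ,
      left-inhabited (to ψ v) (trans (isLeft-ψ v) cv) ,
      right-inhabited (to ψ u) (trans (isLeft-ψ u) cu) ,
      twoCliques⇒≅ tc (twoCliques-K∪K s r) (↔-sym +↔⊎ ↔-∘ ψ)
        (λ x → trans (cong isLeft (splitAt-join s r (to ψ x))) (isLeft-ψ x))
      where open ColourSplit (colourSplit n c)

module _ {n : ℕ} {G : Graph n} {c : Fin n → Bool} (tc : TwoCliques G c) where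

  adjacent⇒sameColour : ∀ {x y} → Adj G x y → c x ≡ c y
  adjacent⇒sameColour {x} {y} x~y = proj₁ (Equivalence.to (adj⇔ tc x y) x~y)

  singleton-¬dominating : ∀ {x y} → c x ≢ c y → ¬ Dominating G (_≡ x)
  singleton-¬dominating {x} {y} cx≢cy dom with dom y (cx≢cy ∘ cong c ∘ ≡-sym)
  ... | _ , refl , y~x = cx≢cy (≡-sym (adjacent⇒sameColour y~x))

  uniqueNeighbour : ∀ {x y w} (S : VSet n) → (∀ z → S z → z ≡ x ⊎ z ≡ y) → S x →
                    c w ≡ c x → c w ≢ c y → w ≢ x → ExactlyOneNbr G S w
  uniqueNeighbour {x} {y} {w} S S⊆xy Sx cw≡cx cw≢cy w≢x =
    x , Sx , Equivalence.from (adj⇔ tc w x) (cw≡cx , w≢x) , onlyX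
    where
      onlyX : ∀ z → S z → Adj G w z → z ≡ x
      onlyX z Sz w~z with S⊆xy z Sz
      ... | inj₁ z≡x = z≡x
      ... | inj₂ refl = ⊥-elim (cw≢cy (adjacent⇒sameColour w~z))

  singletons-perfectCoalition : ∀ {x y} → c x ≢ c y → PerfectCoalition G (_≡ x) (_≡ y)
  singletons-perfectCoalition {x} {y} cx≢cy =
    disjoint , singleton-¬dominating cx≢cy , singleton-¬dominating (cx≢cy ∘ ≡-sym) ,
    atMostOne , atMostOne , perfect
    where
      disjoint : Disjoint G (_≡ x) (_≡ y)
      disjoint _ refl refl = cx≢cy refl
      atMostOne : ∀ {z} v → ¬ v ≡ z → AtMostOneNbr G (_≡ z) v
      atMostOne _ _ _ _ refl refl _ _ = refl
      perfect : PerfectDominating G (Union G (_≡ x) (_≡ y))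
      perfect w w∉ with c w ≟ᵇ c x
      ... | yes cw≡cx = uniqueNeighbour _ (λ _ → id) (inj₁ refl)
                          cw≡cx (cx≢cy ∘ trans (≡-sym cw≡cx)) (w∉ ∘ inj₁)
      ... | no cw≢cx = uniqueNeighbour _ (λ _ → swap) (inj₂ refl)
                         (trans (¬-not cw≢cx) (≡-sym (¬-not (cx≢cy ∘ ≡-sym)))) cw≢cx (w∉ ∘ inj₂)

unionOfTwoCliques⇒PRC : ∀ {n} {G : Graph n} → UnionOfTwoCliques G → PRCis G n
unionOfTwoCliques⇒PRC {G = G} (c , tc , hasColour) =
  inj₁ ((discrete G , isPrc) , λ _ (π , _) → partition-size≤ π)
  where
    isPrc : IsPrcPartition G (discrete G)
    isPrc i with hasColour (not (c i))
    ... | j , cj≡¬ci =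
      inj₂ (j , (λ j≡i → ci≢cj (cong c (≡-sym j≡i))) , singletons-perfectCoalition tc ci≢cj)
      where
        ci≢cj : c i ≢ c j
        ci≢cj ci≡cj = not-¬ refl (trans ci≡cj cj≡¬ci)

prc-partner : ∀ {n} {G : Graph n} → Disconnected G → (π : Partition G n) → IsPrcPartition G π →
              ∀ x → ∃[ y ] (y ≢ x × PairDominating G x y)
prc-partner {G = G} disc π prc x with prc (Partition.cls π x)
... | inj₁ (_ , dom) =
  ⊥-elim (disc (dominating-⊆singleton⇒connected G dom (λ _ → cls-injective π)))
... | inj₂ (j , j≢cx , (_ , _ , _ , _ , _ , perfect)) = y , y≢x , pairDominating
  where
    open Partition π using (cls)
    y : Fin _
    y = representative π j
    y≢x : y ≢ x
    y≢x y≡x = j≢cx (trans (≡-sym (cls-representative π j)) (cong cls y≡x))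
    cls≡j⇒≡y : ∀ {z} → cls z ≡ j → z ≡ y
    cls≡j⇒≡y cz≡j = cls-injective π (trans cz≡j (≡-sym (cls-representative π j)))
    pairDominating : PairDominating G x y
    pairDominating w w≢x w≢y with perfect w [ w≢x ∘ cls-injective π , w≢y ∘ cls≡j⇒≡y ]′
    ... | z , inj₁ cz≡cx , w~z , _ = inj₁ (subst (Adj G w) (cls-injective π cz≡cx) w~z)
    ... | z , inj₂ cz≡j  , w~z , _ = inj₂ (subst (Adj G w) (cls≡j⇒≡y cz≡j) w~z)

module DisconnectedPairDominated
  {n : ℕ} (G : Graph n) (disc : Disconnected G)
  (partner : Fin n → Fin n) (partner≢ : ∀ x → partner x ≢ x)
  (pairDominating : ∀ x → PairDominating G x (partner x))
  (v : Fin n) where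

  u : Fin n
  u = partner v

  base : Bool → Fin n
  base true  = v
  base false = u

  data Near (b : Bool) (w : Fin n) : Set where
    is-base  : w ≡ base b → Near b w
    adj-base : Adj G w (base b) → Near b w

  -- Adj need not be decidable, so the colour of w is read off the witness of domination by {v, u}.
  near : ∀ w → Σ Bool λ b → Near b w
  near w with w ≟ v | w ≟ u
  ... | yes w≡v | _       = true , is-base w≡v
  ... | no _    | yes w≡u = false , is-base w≡u
  ... | no w≢v  | no w≢u  =
    [ (λ w~v → true , adj-base w~v) , (λ w~u → false , adj-base w~u) ]′
      (pairDominating v w w≢v w≢u)

  colour : Fin n → Bool
  colour w = proj₁ (near w)

  near⇒reach : ∀ {b w} → Near b w → Reachable G w (base b)
  near⇒reach (is-base refl) = here
  near⇒reach (adj-base w~b) = step w~b here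

  linked⇒connected : Reachable G v u → Connected G
  linked⇒connected v⇝u = reachAll⇒connected G v to-v
    where
      to-v : ∀ w → Reachable G w v
      to-v w with near w
      ... | true  , w-near = near⇒reach w-near
      ... | false , w-near = reach-trans G (near⇒reach w-near) (reach-sym G v⇝u)

  edge-across⇒linked : ∀ {a b} → colour a ≢ colour b → Adj G a b → Reachable G v u
  edge-across⇒linked {a} {b} with near a | near b
  ... | true  , a-near | false , b-near = λ _ a~b →
    reach-trans G (reach-sym G (near⇒reach a-near)) (step a~b (near⇒reach b-near))
  ... | false , a-near | true  , b-near = λ _ a~b →
    reach-trans G (reach-sym G (near⇒reach b-near)) (step (sym G a~b) (near⇒reach a-near))
  ... | true  , _ | true  , _ = λ ca≢cb → ⊥-elim (ca≢cb refl)
  ... | false , _ | false , _ = λ ca≢cb → ⊥-elim (ca≢cb refl)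

  no-edge-across : ∀ {a b} → colour a ≢ colour b → ¬ Adj G a b
  no-edge-across ca≢cb a~b = disc (linked⇒connected (edge-across⇒linked ca≢cb a~b))

  colour-base : ∀ b → colour (base b) ≡ b
  colour-base true with near v
  ... | true  , _            = refl
  ... | false , is-base v≡u  = ⊥-elim (partner≢ v (≡-sym v≡u))
  ... | false , adj-base v~u = ⊥-elim (disc (linked⇒connected (step v~u here)))
  colour-base false with near u
  ... | false , _            = refl
  ... | true  , is-base u≡v  = ⊥-elim (partner≢ v u≡v)
  ... | true  , adj-base u~v = ⊥-elim (disc (linked⇒connected (step (sym G u~v) here)))

  partner-oppositeColour : ∀ x → colour (partner x) ≢ colour x
  partner-oppositeColour x same =
    [ no-edge-across (cw≢ x refl) , no-edge-across (cw≢ (partner x) same) ]′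
      (pairDominating x w (w≢ x refl) (w≢ (partner x) same))
    where
      w : Fin n
      w = base (not (colour x))
      cw≢ : ∀ y → colour y ≡ colour x → colour w ≢ colour y
      cw≢ _ cy≡cx cw≡cy = not-¬ cy≡cx (trans (≡-sym cw≡cy) (colour-base (not (colour x))))
      w≢ : ∀ y → colour y ≡ colour x → w ≢ y
      w≢ y cy≡cx w≡y = cw≢ y cy≡cx (cong colour w≡y)

  sameColour⇒adjacent : ∀ {x y} → colour x ≡ colour y → x ≢ y → Adj G x y
  sameColour⇒adjacent {x} {y} cx≡cy x≢y =
    [ sym G , ⊥-elim ∘ no-edge-across cy≢cx′ ]′
      (pairDominating x y (x≢y ∘ ≡-sym) (cy≢cx′ ∘ cong colour))
    where
      cy≢cx′ : colour y ≢ colour (partner x)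
      cy≢cx′ cy≡cx′ = partner-oppositeColour x (trans (≡-sym cy≡cx′) (≡-sym cx≡cy))

  twoCliques-colour : TwoCliques G colour
  twoCliques-colour = twoCliques λ x y → mk⇔
    (λ x~y → decidable-stable (colour x ≟ᵇ colour y) (λ cx≢cy → no-edge-across cx≢cy x~y) ,
             λ { refl → irrefl G x~y })
    (λ (cx≡cy , x≢y) → sameColour⇒adjacent cx≡cy x≢y)

  unionOfTwoCliques : UnionOfTwoCliques G
  unionOfTwoCliques = colour , twoCliques-colour , λ b → base b , colour-base b

PRC⇔unionOfTwoCliques : ∀ {n} (G : Graph n) → Disconnected G → PRCis G n ⇔ UnionOfTwoCliques G
PRC⇔unionOfTwoCliques {n} G disc = mk⇔ PRC⇒unionOfTwoCliques unionOfTwoCliques⇒PRC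
  where
    PRC⇒unionOfTwoCliques : PRCis G n → UnionOfTwoCliques G
    PRC⇒unionOfTwoCliques (inj₂ (refl , _)) = ⊥-elim (disc λ ())
    PRC⇒unionOfTwoCliques (inj₁ ((π , prc) , _)) = DisconnectedPairDominated.unionOfTwoCliques
      G disc (proj₁ ∘ partnerOf) (proj₁ ∘ proj₂ ∘ partnerOf) (proj₂ ∘ proj₂ ∘ partnerOf)
      (disconnected⇒vertex G disc)
      where
        partnerOf : ∀ x → ∃[ y ] (y ≢ x × PairDominating G x y)
        partnerOf = prc-partner disc π prc

mainTheorem10 : (n : ℕ) (G : Graph n) → Disconnected G →
    PRCis G n ⇔ (∃[ s ] ∃[ r ] (s ≥ 1 × r ≥ 1 × G ≅ (K s ∪ᴳ K r)))
mainTheorem10 n G disc =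
  ⇔-trans (PRC⇔unionOfTwoCliques G disc) (⇔-sym (≅K∪K⇔unionOfTwoCliques G))
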